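{- Let $n\geq3$ and $k\geq3$, and suppose the circuit $[a_0,a_1,\dots,a_{n-1}]$ in $B_k(n-1)$ has period $c$ and contains two distinct negasymmetric $n$-tuples. Then $c$ is even and the two negasymmetric $n$-tuples are at distance exactly $c/2$ apart (i.e. one is obtained from the other by cyclically shifting by $c/2$ positions).
   Context: Tuples are $k$-ary (entries in $\mathbb{Z}_k$), negation is modulo $k$, $\mathbf{u}^R$ is the reverse of $\mathbf{u}$; a tuple $\mathbf{u}$ is negasymmetric if $\mathbf{u}=-\mathbf{u}^R$. $B_k(n-1)$ is the de Bruijn digraph with vertices the $k$-ary $(n-1)$-tuples and edges the $k$-ary $n$-tuples $(a_0,\dots,a_{n-1})$ from $(a_0,\dots,a_{n-2})$ to $(a_1,\dots,a_{n-1})$. For an $n$-tuple $(a_0,\dots,a_{n-1})$, with $p$ the least positive $d$ such that $a_i=a_{(i+d)\bmod n}$ for all $i$, $[a_0,\dots,a_{n-1}]$ is the circuit whose edges (the $n$-tuples it contains) are the $p$ cyclic shifts $(a_j,\dots,a_{j+n-1})$ (indices mod $n$), $0\le j<p$; $p$ is its period. -}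

module Defs where

open import Data.Nat using (ℕ; zero; suc; _+_; _*_; _∸_; _<_; NonZero)
open import Data.Nat.DivMod using (_%_; m%n<n)
open import Data.Fin using (Fin; toℕ; fromℕ<; opposite)
open import Data.Product using (Σ; _×_)
open import Relation.Binary.PropositionalEquality using (_≡_)

Tuple : ℕ → ℕ → Set
Tuple k n = Fin n → Fin k

modF : ∀ (n : ℕ) .{{_ : NonZero n}} → ℕ → Fin n
modF n m = fromℕ< (m%n<n m n)

negMod : ∀ {k} .{{_ : NonZero k}} → Fin k → Fin k
negMod {k} x = modF k (k ∸ toℕ x)

negT : ∀ {k n} .{{_ : NonZero k}} → Tuple k n → Tuple k n
negT u i = negMod (u i)

rev : ∀ {k n} → Tuple k n → Tuple k n
rev u i = u (opposite i)

_≈T_ : ∀ {k n} → Tuple k n → Tuple k n → Set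
u ≈T v = ∀ i → u i ≡ v i

Negasymmetric : ∀ {k n} .{{_ : NonZero k}} → Tuple k n → Set
Negasymmetric u = u ≈T negT (rev u)

shift : ∀ {k n} .{{_ : NonZero n}} → ℕ → Tuple k n → Tuple k n
shift {n = n} j a i = a (modF n (toℕ i + j))

IsCyclicPeriod : ∀ {k n} .{{_ : NonZero n}} → Tuple k n → ℕ → Set
IsCyclicPeriod a d = (0 < d) × (a ≈T shift d a)

Period : ∀ {k n} .{{_ : NonZero n}} → Tuple k n → ℕ → Set
Period a p = IsCyclicPeriod a p × (∀ d → IsCyclicPeriod a d → p Data.Nat.≤ d)

-- The n-tuple u is an edge of the circuit [a_0,…,a_{n-1}] whose period is p:
-- u is one of the cyclic shifts (a_j,…,a_{j+n-1}), 0 ≤ j < p.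
InCircuit : ∀ {k n} .{{_ : NonZero n}} → Tuple k n → ℕ → Tuple k n → Set
InCircuit a p u = Σ ℕ (λ j → (j < p) × (u ≈T shift j a))

-- Extend the tuple a n-periodically to a sequence A on ℕ. The edge of the circuit starting at offset i is
-- negasymmetric exactly when A is negated by the reflection x ↦ (n - 1 + 2i) - x modulo n.
-- Two such reflections, at offsets i < j, compose to the translation by 2(j - i), which is
-- therefore a period. Since 0 < j - i < c and c is the least period, 2(j - i) = c: otherwise
-- 2(j - i) - c would be a smaller positive period.
module Submission where

open import Defs
open import Data.Nat using (ℕ; _≤_; _*_; NonZero)
open import Data.Product using (Σ; _×_)
open import Relation.Nullary using (¬_)
open import Relation.Binary.PropositionalEquality using (_≡_)

open import Data.Nat using (suc; _+_; _∸_; _<_; pred)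
open import Data.Nat.DivMod using (_%_; m%n<n; m%n%n≡m%n; [m+kn]%n≡m%n; %-distribˡ-+; m<n⇒m%n≡m)
open import Data.Nat.Properties
  using (+-comm; +-assoc; +-identityʳ; +-suc; *-comm; suc-pred; m∸n+n≡m; m+n∸n≡m; m+[n∸m]≡n;
         m∸n≤m; ∸-monoˡ-<; m<n⇒0<n∸m; *-monoʳ-<; <⇒≤; <⇒≱; ≤-<-trans; m≤n⇒m<n∨m≡n; <-cmp)
open import Data.Nat.Tactic.RingSolver using (solve-∀)
open import Data.Fin using (Fin; toℕ; opposite)
open import Data.Fin.Properties using (toℕ-injective; toℕ-fromℕ<; toℕ<n; opposite-prop)
open import Data.Product using (_,_; ∃; proj₁; proj₂)
open import Data.Sum using (inj₁; inj₂)
open import Data.Empty using (⊥-elim)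
open import Relation.Binary.Definitions using (tri<; tri≈; tri>)
open import Relation.Binary.PropositionalEquality
  using (_≗_; refl; sym; trans; cong; subst; module ≡-Reasoning)

module Modular (n : ℕ) .{{_ : NonZero n}} where
  open ≡-Reasoning

  infix 4 _≋_
  _≋_ : ℕ → ℕ → Set
  x ≋ y = x % n ≡ y % n

  %-≋ : ∀ x → x % n ≋ x
  %-≋ x = m%n%n≡m%n x n

  +-congʳ-≋ : ∀ {x y} z → x ≋ y → x + z ≋ y + z
  +-congʳ-≋ {x} {y} z x≋y = begin
    (x + z) % n           ≡⟨ %-distribˡ-+ x z n ⟩
    (x % n + z % n) % n   ≡⟨ cong (λ w → (w + z % n) % n) x≋y ⟩
    (y % n + z % n) % n   ≡⟨ %-distribˡ-+ y z n ⟨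
    (y + z) % n           ∎

  +-congˡ-≋ : ∀ z {x y} → x ≋ y → z + x ≋ z + y
  +-congˡ-≋ z {x} {y} x≋y = begin
    (z + x) % n ≡⟨ cong (_% n) (+-comm z x) ⟩
    (x + z) % n ≡⟨ +-congʳ-≋ z x≋y ⟩
    (y + z) % n ≡⟨ cong (_% n) (+-comm y z) ⟩
    (z + y) % n ∎

  +-cong-≋ : ∀ {x x′ y y′} → x ≋ x′ → y ≋ y′ → x + y ≋ x′ + y′
  +-cong-≋ {x′ = x′} {y} x≋x′ y≋y′ = trans (+-congʳ-≋ y x≋x′) (+-congˡ-≋ x′ y≋y′)

  -- Subtraction of i modulo n, without truncation: x + (n - 1) * i is congruent to x - i.
  ∃-+-≋ : ∀ x i → ∃ λ y → y + i ≋ x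
  ∃-+-≋ x i = x + pred n * i , (begin
    (x + pred n * i + i) % n   ≡⟨ cong (_% n) (+-assoc x (pred n * i) i) ⟩
    (x + (pred n * i + i)) % n ≡⟨ cong (λ w → (x + w) % n) pred-n*i+i≡i*n ⟩
    (x + i * n) % n            ≡⟨ [m+kn]%n≡m%n x i n ⟩
    x % n                      ∎)
    where
    pred-n*i+i≡i*n : pred n * i + i ≡ i * n
    pred-n*i+i≡i*n = begin
      pred n * i + i   ≡⟨ +-comm (pred n * i) i ⟩
      suc (pred n) * i ≡⟨ cong (_* i) (suc-pred n) ⟩
      n * i            ≡⟨ *-comm n i ⟩
      i * n            ∎

  +-cancelʳ-≋ : ∀ {x y} z → x + z ≋ y + z → x ≋ y
  +-cancelʳ-≋ {x} {y} z x+z≋y+z = begin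
    x % n             ≡⟨ absorb x ⟨
    (x + (z + w)) % n ≡⟨ cong (_% n) (+-assoc x z w) ⟨
    (x + z + w) % n   ≡⟨ +-congʳ-≋ w x+z≋y+z ⟩
    (y + z + w) % n   ≡⟨ cong (_% n) (+-assoc y z w) ⟩
    (y + (z + w)) % n ≡⟨ absorb y ⟩
    y % n             ∎
    where
    w = proj₁ (∃-+-≋ 0 z)
    absorb : ∀ x → x + (z + w) ≋ x
    absorb x = trans (+-congˡ-≋ x (trans (cong (_% n) (+-comm z w)) (proj₂ (∃-+-≋ 0 z))))
                     (cong (_% n) (+-identityʳ x))

  toℕ-modF-≋ : ∀ x → toℕ (modF n x) ≋ x
  toℕ-modF-≋ x = trans (cong (_% n) (toℕ-fromℕ< (m%n<n x n))) (%-≋ x)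

  toℕ-≋-injective : ∀ {s t : Fin n} → toℕ s ≋ toℕ t → s ≡ t
  toℕ-≋-injective {s} {t} s≋t = toℕ-injective (begin
    toℕ s     ≡⟨ m<n⇒m%n≡m (toℕ<n s) ⟨
    toℕ s % n ≡⟨ s≋t ⟩
    toℕ t % n ≡⟨ m<n⇒m%n≡m (toℕ<n t) ⟩
    toℕ t     ∎)

module _ {k : ℕ} .{{_ : NonZero k}} where
  open Modular k

  toℕ-negMod+toℕ≋k : ∀ (x : Fin k) → toℕ (negMod x) + toℕ x ≋ k
  toℕ-negMod+toℕ≋k x = begin
    (toℕ (negMod x) + toℕ x) % k ≡⟨ +-congʳ-≋ (toℕ x) (toℕ-modF-≋ (k ∸ toℕ x)) ⟩
    (k ∸ toℕ x + toℕ x) % k      ≡⟨ cong (_% k) (m∸n+n≡m (<⇒≤ (toℕ<n x))) ⟩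
    k % k                        ∎
    where open ≡-Reasoning

  negMod-involutive : ∀ (x : Fin k) → negMod (negMod x) ≡ x
  negMod-involutive x = toℕ-≋-injective (+-cancelʳ-≋ (toℕ (negMod x))
    (trans (toℕ-negMod+toℕ≋k (negMod x)) (sym (trans (cong (_% k) (+-comm (toℕ x) _)) (toℕ-negMod+toℕ≋k x)))))

toℕ-opposite+toℕ : ∀ {n} (t : Fin n) → toℕ (opposite t) + toℕ t ≡ pred n
toℕ-opposite+toℕ {n} t = begin
  toℕ (opposite t) + toℕ t             ≡⟨ cong (_+ toℕ t) (opposite-prop t) ⟩
  n ∸ suc (toℕ t) + toℕ t              ≡⟨ cong pred (+-suc (n ∸ suc (toℕ t)) (toℕ t)) ⟨
  pred (n ∸ suc (toℕ t) + suc (toℕ t)) ≡⟨ cong pred (m∸n+n≡m (toℕ<n t)) ⟩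
  pred n                               ∎
  where open ≡-Reasoning

Periodic : ∀ {A : Set} → (ℕ → A) → ℕ → Set
Periodic g d = ∀ x → g x ≡ g (x + d)

periodic-∸ : ∀ {A : Set} {g : ℕ → A} {p q} → Periodic g p → Periodic g q → q ≤ p →
             Periodic g (p ∸ q)
periodic-∸ {g = g} {p} {q} g-p g-q q≤p x = begin
  g x                   ≡⟨ g-p x ⟩
  g (x + p)             ≡⟨ cong g x+p≡x+[p∸q]+q ⟩
  g (x + (p ∸ q) + q)   ≡⟨ g-q (x + (p ∸ q)) ⟨
  g (x + (p ∸ q))       ∎
  where
  open ≡-Reasoning
  x+p≡x+[p∸q]+q : x + p ≡ x + (p ∸ q) + q
  x+p≡x+[p∸q]+q = trans (cong (x +_) (sym (m∸n+n≡m q≤p))) (sym (+-assoc x (p ∸ q) q))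

module Circuit (n : ℕ) .{{_ : NonZero n}} where
  open Modular n
  open ≡-Reasoning

  cyclic : ∀ {k} → Tuple k n → ℕ → Fin k
  cyclic a x = a (modF n x)

  module _ {k : ℕ} where

    cyclic-cong : ∀ (a : Tuple k n) {x y} → x ≋ y → cyclic a x ≡ cyclic a y
    cyclic-cong a {x} {y} x≋y =
      cong a (toℕ-≋-injective (trans (toℕ-modF-≋ x) (trans x≋y (sym (toℕ-modF-≋ y)))))

    cyclic-toℕ : ∀ (a : Tuple k n) t → cyclic a (toℕ t) ≡ a t
    cyclic-toℕ a t = cong a (toℕ-≋-injective (toℕ-modF-≋ (toℕ t)))

    cyclic-resp-≈T : ∀ {u v : Tuple k n} → u ≈T v → cyclic u ≗ cyclic v
    cyclic-resp-≈T u≈v x = u≈v (modF n x)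

    cyclic-shift : ∀ j (a : Tuple k n) x → cyclic (shift j a) x ≡ cyclic a (x + j)
    cyclic-shift j a x = cyclic-cong a (+-congʳ-≋ j (toℕ-modF-≋ x))

    shift-≈T : ∀ {u a : Tuple k n} {i} d → u ≈T shift i a → shift d u ≈T shift (d + i) a
    shift-≈T {u} {a} {i} d u≈ t = begin
      cyclic u (toℕ t + d)           ≡⟨ cyclic-resp-≈T u≈ (toℕ t + d) ⟩
      cyclic (shift i a) (toℕ t + d) ≡⟨ cyclic-shift i a (toℕ t + d) ⟩
      cyclic a (toℕ t + d + i)       ≡⟨ cong (cyclic a) (+-assoc (toℕ t) d i) ⟩
      cyclic a (toℕ t + (d + i))     ∎

    ≈T-shift⇒periodic : ∀ {a : Tuple k n} {d} → a ≈T shift d a → Periodic (cyclic a) d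
    ≈T-shift⇒periodic {a} {d} a≈ x = trans (cyclic-resp-≈T a≈ x) (cyclic-shift d a x)

    periodic⇒≈T-shift : ∀ {a : Tuple k n} {d} → Periodic (cyclic a) d → a ≈T shift d a
    periodic⇒≈T-shift {a} per t = trans (sym (cyclic-toℕ a t)) (per (toℕ t))

    shift-+-period : ∀ {a : Tuple k n} {c} j → IsCyclicPeriod a c → shift (j + c) a ≈T shift j a
    shift-+-period {a} {c} j (_ , a≈) t = begin
      cyclic a (toℕ t + (j + c)) ≡⟨ cong (cyclic a) (+-assoc (toℕ t) j c) ⟨
      cyclic a (toℕ t + j + c)   ≡⟨ ≈T-shift⇒periodic a≈ (toℕ t + j) ⟨
      cyclic a (toℕ t + j)       ∎

    isCyclicPeriod-∸ : ∀ {a : Tuple k n} {p q} → IsCyclicPeriod a p → IsCyclicPeriod a q → q < p →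
                       IsCyclicPeriod a (p ∸ q)
    isCyclicPeriod-∸ (_ , a≈p) (_ , a≈q) q<p = m<n⇒0<n∸m q<p ,
      periodic⇒≈T-shift (periodic-∸ (≈T-shift⇒periodic a≈p) (≈T-shift⇒periodic a≈q) (<⇒≤ q<p))

    least-period-unique : ∀ {a : Tuple k n} {c e} → Period a c → IsCyclicPeriod a e → e < 2 * c → e ≡ c
    least-period-unique {c = c} {e} (c-period , least) e-period e<2c
      with m≤n⇒m<n∨m≡n (least e e-period)
    ... | inj₂ c≡e = sym c≡e
    ... | inj₁ c<e = ⊥-elim (<⇒≱ e∸c<c (least (e ∸ c) (isCyclicPeriod-∸ e-period c-period c<e)))
      where
      e∸c<c : e ∸ c < c
      e∸c<c = subst (e ∸ c <_) (m+n∸n≡m c c)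
                (∸-monoˡ-< (subst (e <_) (cong (c +_) (+-identityʳ c)) e<2c) (<⇒≤ c<e))

  module _ {k : ℕ} .{{_ : NonZero k}} where

    NegMirror : (ℕ → Fin k) → ℕ → Set
    NegMirror g m = ∀ x y → x + y ≋ m → g x ≡ negMod (g y)

    negMirror-resp : ∀ {g h : ℕ → Fin k} {m} → g ≗ h → NegMirror g m → NegMirror h m
    negMirror-resp g≗h g-mirror x y x+y≋m =
      trans (sym (g≗h x)) (trans (g-mirror x y x+y≋m) (cong negMod (g≗h y)))

    negasymmetric⇒negMirror : ∀ {u : Tuple k n} → Negasymmetric u → NegMirror (cyclic u) (pred n)
    negasymmetric⇒negMirror {u} u-neg x y x+y≋ = begin
      u t                                  ≡⟨ u-neg t ⟩
      negMod (u (opposite t))              ≡⟨ cong negMod (cyclic-toℕ u (opposite t)) ⟨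
      negMod (cyclic u (toℕ (opposite t))) ≡⟨ cong negMod (cyclic-cong u opposite-t≋y) ⟩
      negMod (cyclic u y)                  ∎
      where
      t = modF n x
      opposite-t≋y : toℕ (opposite t) ≋ y
      opposite-t≋y = +-cancelʳ-≋ x (begin
        (toℕ (opposite t) + x) % n      ≡⟨ +-congˡ-≋ (toℕ (opposite t)) (toℕ-modF-≋ x) ⟨
        (toℕ (opposite t) + toℕ t) % n  ≡⟨ cong (_% n) (toℕ-opposite+toℕ t) ⟩
        pred n % n                      ≡⟨ x+y≋ ⟨
        (x + y) % n                     ≡⟨ cong (_% n) (+-comm x y) ⟩
        (y + x) % n                     ∎)

    negMirror-shift : ∀ {a : Tuple k n} {m} i → NegMirror (λ x → cyclic a (x + i)) m →
                      NegMirror (cyclic a) (m + 2 * i)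
    negMirror-shift {a} {m} i shifted-mirror x y x+y≋ = begin
      cyclic a x                 ≡⟨ cyclic-cong a x′+i≋x ⟨
      cyclic a (x′ + i)          ≡⟨ shifted-mirror x′ y′ x′+y′≋m ⟩
      negMod (cyclic a (y′ + i)) ≡⟨ cong negMod (cyclic-cong a y′+i≋y) ⟩
      negMod (cyclic a y)        ∎
      where
      x′ = proj₁ (∃-+-≋ x i)
      x′+i≋x = proj₂ (∃-+-≋ x i)
      y′ = proj₁ (∃-+-≋ y i)
      y′+i≋y = proj₂ (∃-+-≋ y i)
      x′+y′≋m : x′ + y′ ≋ m
      x′+y′≋m = +-cancelʳ-≋ (2 * i) (begin
        (x′ + y′ + 2 * i) % n     ≡⟨ cong (_% n) (a+b+2c≡[a+c]+[b+c] x′ y′ i) ⟩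
        ((x′ + i) + (y′ + i)) % n ≡⟨ +-cong-≋ x′+i≋x y′+i≋y ⟩
        (x + y) % n               ≡⟨ x+y≋ ⟩
        (m + 2 * i) % n           ∎)
        where
        a+b+2c≡[a+c]+[b+c] : ∀ a b c → a + b + 2 * c ≡ (a + c) + (b + c)
        a+b+2c≡[a+c]+[b+c] = solve-∀

    -- Composing the reflections about m/2 and (m + e)/2 translates by e.
    negMirrors⇒periodic : ∀ {g : ℕ → Fin k} {m e} → NegMirror g m → NegMirror g (m + e) → Periodic g e
    negMirrors⇒periodic {g} {m} {e} g-m g-m+e x = begin
      g x                         ≡⟨ g-m x y (trans (cong (_% n) (+-comm x y)) y+x≋m) ⟩
      negMod (g y)                ≡⟨ cong negMod (g-m+e y (x + e) y+[x+e]≋m+e) ⟩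
      negMod (negMod (g (x + e))) ≡⟨ negMod-involutive (g (x + e)) ⟩
      g (x + e)                   ∎
      where
      y = proj₁ (∃-+-≋ m x)
      y+x≋m = proj₂ (∃-+-≋ m x)
      y+[x+e]≋m+e : y + (x + e) ≋ m + e
      y+[x+e]≋m+e = trans (cong (_% n) (sym (+-assoc y x e))) (+-congʳ-≋ e y+x≋m)

    inCircuit-negMirror : ∀ {a u : Tuple k n} {i} → u ≈T shift i a → Negasymmetric u →
                          NegMirror (cyclic a) (pred n + 2 * i)
    inCircuit-negMirror {a} {u} {i} u≈ u-neg = negMirror-shift {a = a} i (negMirror-resp {g = cyclic u}
      (λ x → trans (cyclic-resp-≈T u≈ x) (cyclic-shift i a x)) (negasymmetric⇒negMirror {u = u} u-neg))

    negasymmetric-edges : ∀ {a u v : Tuple k n} {c i j} → Period a c → i < j → j < c →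
      u ≈T shift i a → v ≈T shift j a → Negasymmetric u → Negasymmetric v →
      c ≡ 2 * (j ∸ i) × v ≈T shift (j ∸ i) u × u ≈T shift (j ∸ i) v
    negasymmetric-edges {a} {u} {v} {c} {i} {j} c-period i<j j<c u≈ v≈ u-neg v-neg =
      c≡2d , v≈shift-d-u , u≈shift-d-v
      where
      d = j ∸ i
      j≡i+d : j ≡ i + d
      j≡i+d = sym (m+[n∸m]≡n (<⇒≤ i<j))

      m+2[i+d]≡m+2i+2d : ∀ m i d → m + 2 * (i + d) ≡ m + 2 * i + 2 * d
      m+2[i+d]≡m+2i+2d = solve-∀

      mirror-v : NegMirror (cyclic a) (pred n + 2 * i + 2 * d)
      mirror-v = subst (NegMirror (cyclic a))
        (trans (cong (λ j → pred n + 2 * j) j≡i+d) (m+2[i+d]≡m+2i+2d (pred n) i d))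
        (inCircuit-negMirror {a = a} {v} {j} v≈ v-neg)

      2d-period : IsCyclicPeriod a (2 * d)
      2d-period = *-monoʳ-< 2 (m<n⇒0<n∸m i<j) ,
        periodic⇒≈T-shift (negMirrors⇒periodic (inCircuit-negMirror {a = a} {u} {i} u≈ u-neg) mirror-v)

      c≡2d : c ≡ 2 * d
      c≡2d = sym (least-period-unique c-period 2d-period (*-monoʳ-< 2 (≤-<-trans (m∸n≤m j i) j<c)))

      i+2d≡d+[i+d] : ∀ i d → i + 2 * d ≡ d + (i + d)
      i+2d≡d+[i+d] = solve-∀

      v≈shift-d-u : v ≈T shift d u
      v≈shift-d-u t = begin
        v t               ≡⟨ v≈ t ⟩
        shift j a t       ≡⟨ cong (λ j → shift j a t) (trans j≡i+d (+-comm i d)) ⟩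
        shift (d + i) a t ≡⟨ shift-≈T {a = a} d u≈ t ⟨
        shift d u t       ∎

      u≈shift-d-v : u ≈T shift d v
      u≈shift-d-v t = begin
        u t                     ≡⟨ u≈ t ⟩
        shift i a t             ≡⟨ shift-+-period i (proj₁ c-period) t ⟨
        shift (i + c) a t       ≡⟨ cong (λ j → shift (i + j) a t) c≡2d ⟩
        shift (i + 2 * d) a t   ≡⟨ cong (λ j → shift j a t) (i+2d≡d+[i+d] i d) ⟩
        shift (d + (i + d)) a t ≡⟨ cong (λ j → shift (d + j) a t) j≡i+d ⟨
        shift (d + j) a t       ≡⟨ shift-≈T {a = a} d v≈ t ⟨
        shift d v t             ∎

open Circuit using (negasymmetric-edges)

corollary2p8 : ∀ (n k : ℕ) .{{_ : NonZero n}} .{{_ : NonZero k}} →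
    3 ≤ n → 3 ≤ k →
    (a : Tuple k n) (c : ℕ) → Period a c →
    (u v : Tuple k n) → InCircuit a c u → InCircuit a c v →
    ¬ (u ≈T v) → Negasymmetric u → Negasymmetric v →
    Σ ℕ (λ m → (c ≡ 2 * m) × (v ≈T shift m u))
corollary2p8 n k _ _ a c c-period u v (i , i<c , u≈) (j , j<c , v≈) u≉v u-neg v-neg
  with <-cmp i j
... | tri≈ _ refl _ = ⊥-elim (u≉v (λ t → trans (u≈ t) (sym (v≈ t))))
... | tri< i<j _ _ =
  let c≡2d , v≈shift-d-u , _ = negasymmetric-edges n c-period i<j j<c u≈ v≈ u-neg v-neg
  in j ∸ i , c≡2d , v≈shift-d-u
... | tri> _ _ j<i =
  let c≡2d , _ , v≈shift-d-u = negasymmetric-edges n c-period j<i i<c v≈ u≈ v-neg u-neg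
  in i ∸ j , c≡2d , v≈shift-d-u
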